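{- Let $G_1$ and $G_2$ be module-composed graphs. Then their disjoint union $G_1\cup G_2$ is module-composed.
   Context: All graphs are finite, simple and undirected. For a graph $G=(V_G,E_G)$ and $v\in V_G$, $N(v)=\{w\in V_G : \{v,w\}\in E_G\}$. A set $M\subseteq V_G$ is a module of $G$ if for all $v_1,v_2\in M$ we have $N(v_1)\setminus M=N(v_2)\setminus M$ (in particular the empty set, singletons and $V_G$ are modules). For $U\subseteq V_G$, $G[U]$ is the induced subgraph on $U$. A graph $G$ is module-composed if there is a bijection $\varphi:V_G\to\{1,\ldots,|V_G|\}$ such that for every $2\le i\le |V_G|$ the neighbourhood of $\varphi^{ -1}(i)$ in the graph $G[\{\varphi^{ -1}(1),\ldots,\varphi^{ -1}(i-1)\}]$ is a module of that graph; such $\varphi$ is called a module-sequence. -}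

module Defs where

open import Data.Nat using (ℕ; _+_; _<_)
open import Data.Fin using (Fin; toℕ; splitAt)
open import Data.Bool using (Bool; true; false)
open import Data.Sum using (_⊎_; inj₁; inj₂)
open import Data.Product using (Σ; _×_)
open import Relation.Binary.PropositionalEquality using (_≡_)
open import Relation.Nullary using (¬_)
open import Function.Bundles using (_⤖_; Bijection)

record Graph : Set where
  field
    size  : ℕ
    adj   : Fin size → Fin size → Bool
    sym   : ∀ u v → adj u v ≡ adj v u
    irref : ∀ v → adj v v ≡ false
open Graph public

-- M is a module of the induced subgraph G[U], with U and M given as
-- predicates on V_G (M is assumed to be a subset of U where used):
-- for all a, b ∈ M, N(a) \ M = N(b) \ M within G[U], i.e. for every
-- w ∈ U \ M, a ~ w iff b ~ w.
IsModuleIn : (G : Graph) → (U M : Fin (size G) → Set) → Set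
IsModuleIn G U M =
  ∀ a b w → M a → M b → U w → ¬ M w → adj G a w ≡ adj G b w

-- φ : V_G → {1,…,|V_G|} realised as a bijection onto Fin |V_G|
-- (position toℕ (φ v) + 1).  It is a module-sequence if for each
-- vertex v (the one at position i = toℕ (φ v), 0-based), the
-- neighbourhood of v in the prefix graph G[{u : toℕ (φ u) < i}] is a
-- module of that prefix graph.  (For the first vertex the prefix is
-- empty and the condition is vacuous, matching 2 ≤ i.)
IsModuleSequence : (G : Graph) → (Fin (size G) → Fin (size G)) → Set
IsModuleSequence G φ =
  ∀ v → IsModuleIn G (Prefix v) (λ u → Prefix v u × adj G v u ≡ true)
  where
  Prefix : Fin (size G) → Fin (size G) → Set
  Prefix v u = toℕ (φ u) < toℕ (φ v)

ModuleComposed : Graph → Set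
ModuleComposed G =
  Σ (Fin (size G) ⤖ Fin (size G)) λ φ → IsModuleSequence G (Bijection.to φ)

unionAdj : ∀ {m n} → (Fin m → Fin m → Bool) → (Fin n → Fin n → Bool)
         → Fin (m + n) → Fin (m + n) → Bool
unionAdj {m} a₁ a₂ u v with splitAt m u | splitAt m v
... | inj₁ x | inj₁ y = a₁ x y
... | inj₂ x | inj₂ y = a₂ x y
... | inj₁ _ | inj₂ _ = false
... | inj₂ _ | inj₁ _ = false

unionSym : ∀ {m n} (a₁ : Fin m → Fin m → Bool) (a₂ : Fin n → Fin n → Bool)
         → (∀ u v → a₁ u v ≡ a₁ v u) → (∀ u v → a₂ u v ≡ a₂ v u)
         → ∀ u v → unionAdj a₁ a₂ u v ≡ unionAdj a₁ a₂ v u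
unionSym {m} a₁ a₂ s₁ s₂ u v with splitAt m u | splitAt m v
... | inj₁ x | inj₁ y = s₁ x y
... | inj₂ x | inj₂ y = s₂ x y
... | inj₁ _ | inj₂ _ = Relation.Binary.PropositionalEquality.refl
... | inj₂ _ | inj₁ _ = Relation.Binary.PropositionalEquality.refl

unionIrref : ∀ {m n} (a₁ : Fin m → Fin m → Bool) (a₂ : Fin n → Fin n → Bool)
           → (∀ v → a₁ v v ≡ false) → (∀ v → a₂ v v ≡ false)
           → ∀ v → unionAdj a₁ a₂ v v ≡ false
unionIrref {m} a₁ a₂ i₁ i₂ v with splitAt m v
... | inj₁ x = i₁ x
... | inj₂ x = i₂ x

_⊔_ : Graph → Graph → Graph
G₁ ⊔ G₂ = record
  { size  = size G₁ + size G₂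
  ; adj   = unionAdj (adj G₁) (adj G₂)
  ; sym   = unionSym (adj G₁) (adj G₂) (Graph.sym G₁) (Graph.sym G₂)
  ; irref = unionIrref (adj G₁) (adj G₂) (irref G₁) (irref G₂)
  }

module Submission where

-- Idea: list all vertices of G₁ in the order of a module-sequence φ₁ of
-- G₁, and then all vertices of G₂ in the order of a module-sequence φ₂.
-- It is a module-sequence of G₁ ⊔ G₂:
--  * a left vertex is only preceded by left vertices, and the left copy
--    is an order-reflecting induced copy of G₁, so its condition is that
--    of G₁ (likewise for a right vertex and vertices of G₂ before it);
--  * a right vertex has no neighbours in the left copy, so a left vertex
--    w outside its neighbourhood sees neither of two neighbours a, b.

open import Defs hiding (sym)
open import Data.Nat using (ℕ; _+_; _<_)
open import Data.Nat.Properties using (+-cancelˡ-<; m≤m+n; <-≤-trans; <-asym)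
open import Data.Fin using (Fin; toℕ; splitAt; join; _↑ˡ_; _↑ʳ_)
open import Data.Fin.Properties
  using (toℕ-↑ˡ; toℕ-↑ʳ; toℕ<n; splitAt-↑ˡ; splitAt-↑ʳ; splitAt⁻¹-↑ˡ; splitAt⁻¹-↑ʳ;
         +↔⊎)
open import Data.Bool using (Bool; true; false)
open import Data.Sum as Sum using (inj₁; inj₂)
open import Data.Sum.Function.Propositional using (_⊎-⤖_)
open import Data.Product using (_×_; _,_; proj₁; proj₂)
open import Data.Empty using (⊥-elim)
open import Function using (_∘_)
open import Function.Bundles using (_⤖_)
open import Function.Construct.Composition using (_⤖-∘_)
open import Function.Properties.Inverse using (↔⇒⤖; ↔-sym)
open import Relation.Binary.PropositionalEquality
  using (_≡_; refl; sym; trans; subst; subst₂; module ≡-Reasoning)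
open import Relation.Nullary using (¬_)

data Side (m n : ℕ) : Fin (m + n) → Set where
  left  : (x : Fin m) → Side m n (x ↑ˡ n)
  right : (y : Fin n) → Side m n (m ↑ʳ y)

side : ∀ m n (u : Fin (m + n)) → Side m n u
side m n u with splitAt m u in eq
... | inj₁ x = subst (Side m n) (splitAt⁻¹-↑ˡ eq) (left x)
... | inj₂ y = subst (Side m n) (splitAt⁻¹-↑ʳ eq) (right y)

module _ {m n : ℕ} (a₁ : Fin m → Fin m → Bool) (a₂ : Fin n → Fin n → Bool) where

  unionAdj-ˡˡ : ∀ x y → unionAdj a₁ a₂ (x ↑ˡ n) (y ↑ˡ n) ≡ a₁ x y
  unionAdj-ˡˡ x y rewrite splitAt-↑ˡ m x n | splitAt-↑ˡ m y n = refl

  unionAdj-ʳʳ : ∀ x y → unionAdj a₁ a₂ (m ↑ʳ x) (m ↑ʳ y) ≡ a₂ x y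
  unionAdj-ʳʳ x y rewrite splitAt-↑ʳ m n x | splitAt-↑ʳ m n y = refl

  unionAdj-ʳˡ : ∀ y x → unionAdj a₁ a₂ (m ↑ʳ y) (x ↑ˡ n) ≡ false
  unionAdj-ʳˡ y x rewrite splitAt-↑ʳ m n y | splitAt-↑ˡ m x n = refl

module _ {m n : ℕ} where

  ↑ˡ-reflects-< : ∀ (x y : Fin m) → toℕ (x ↑ˡ n) < toℕ (y ↑ˡ n) → toℕ x < toℕ y
  ↑ˡ-reflects-< x y = subst₂ _<_ (toℕ-↑ˡ x n) (toℕ-↑ˡ y n)

  ↑ʳ-reflects-< : ∀ (x y : Fin n) → toℕ (m ↑ʳ x) < toℕ (m ↑ʳ y) → toℕ x < toℕ y
  ↑ʳ-reflects-< x y = +-cancelˡ-< m _ _ ∘ subst₂ _<_ (toℕ-↑ʳ m x) (toℕ-↑ʳ m y)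

  ↑ˡ<↑ʳ : ∀ (x : Fin m) (y : Fin n) → toℕ (x ↑ˡ n) < toℕ (m ↑ʳ y)
  ↑ˡ<↑ʳ x y = subst₂ _<_ (sym (toℕ-↑ˡ x n)) (sym (toℕ-↑ʳ m y))
                     (<-≤-trans (toℕ<n x) (m≤m+n m (toℕ y)))

Before : ∀ {k} → (Fin k → Fin k) → Fin k → Fin k → Set
Before φ u v = toℕ (φ u) < toℕ (φ v)

PrefixNeighbour : (G : Graph) → (Fin (size G) → Fin (size G)) → Fin (size G) → Fin (size G) → Set
PrefixNeighbour G φ v u = Before φ u v × adj G v u ≡ true

-- The module condition of a module-sequence at vertex v, for the
-- particular witnesses a, b (in the neighbourhood) and w (outside it);
-- IsModuleSequence G φ is exactly ∀ v a b w → ModuleConditionAt G φ v a b w.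
ModuleConditionAt : (G : Graph) → (Fin (size G) → Fin (size G)) → (v a b w : Fin (size G)) → Set
ModuleConditionAt G φ v a b w =
  PrefixNeighbour G φ v a → PrefixNeighbour G φ v b → Before φ w v →
  ¬ PrefixNeighbour G φ v w → adj G a w ≡ adj G b w

embed-moduleCondition :
  ∀ (G H : Graph) {φ : Fin (size G) → Fin (size G)} {ψ : Fin (size H) → Fin (size H)}
  (ι : Fin (size G) → Fin (size H)) →
  (∀ u v → adj H (ι u) (ι v) ≡ adj G u v) →
  (∀ u v → Before ψ (ι u) (ι v) → Before φ u v) →
  IsModuleSequence G φ → ∀ v a b w → ModuleConditionAt H ψ (ι v) (ι a) (ι b) (ι w)
embed-moduleCondition G H {φ} {ψ} ι adj-ι before-ι S v a b w (pa , ea) (pb , eb) pw nw = begin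
  adj H (ι a) (ι w)  ≡⟨ adj-ι a w ⟩
  adj G a w          ≡⟨ S v a b w (pull pa ea) (pull pb eb) (before-ι w v pw) outside ⟩
  adj G b w          ≡⟨ sym (adj-ι b w) ⟩
  adj H (ι b) (ι w)  ∎
  where
  open ≡-Reasoning
  pull : ∀ {u} → Before ψ (ι u) (ι v) → adj H (ι v) (ι u) ≡ true → PrefixNeighbour G φ v u
  pull {u} p e = before-ι u v p , trans (sym (adj-ι v u)) e
  outside : ¬ PrefixNeighbour G φ v w
  outside (_ , e) = nw (pw , trans (adj-ι v w) e)

concatOrder : ∀ {m n} → (Fin m → Fin m) → (Fin n → Fin n) → Fin (m + n) → Fin (m + n)
concatOrder {m} {n} f₁ f₂ = join m n ∘ Sum.map f₁ f₂ ∘ splitAt m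

-- Concatenation of permutations; its underlying map is, definitionally,
-- concatOrder of the two underlying maps.
_++ᵇ_ : ∀ {m n} → Fin m ⤖ Fin m → Fin n ⤖ Fin n → Fin (m + n) ⤖ Fin (m + n)
B₁ ++ᵇ B₂ = ↔⇒⤖ (↔-sym +↔⊎) ⤖-∘ ((B₁ ⊎-⤖ B₂) ⤖-∘ ↔⇒⤖ +↔⊎)

module _ {m n : ℕ} (f₁ : Fin m → Fin m) (f₂ : Fin n → Fin n) where

  concatOrder-↑ˡ : ∀ x → concatOrder f₁ f₂ (x ↑ˡ n) ≡ f₁ x ↑ˡ n
  concatOrder-↑ˡ x rewrite splitAt-↑ˡ m x n = refl

  concatOrder-↑ʳ : ∀ y → concatOrder f₁ f₂ (m ↑ʳ y) ≡ m ↑ʳ f₂ y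
  concatOrder-↑ʳ y rewrite splitAt-↑ʳ m n y = refl

  before-↑ˡ : ∀ x y → Before (concatOrder f₁ f₂) (x ↑ˡ n) (y ↑ˡ n) → Before f₁ x y
  before-↑ˡ x y = ↑ˡ-reflects-< (f₁ x) (f₁ y)
                ∘ subst₂ (λ p q → toℕ p < toℕ q) (concatOrder-↑ˡ x) (concatOrder-↑ˡ y)

  before-↑ʳ : ∀ x y → Before (concatOrder f₁ f₂) (m ↑ʳ x) (m ↑ʳ y) → Before f₂ x y
  before-↑ʳ x y = ↑ʳ-reflects-< (f₂ x) (f₂ y)
                ∘ subst₂ (λ p q → toℕ p < toℕ q) (concatOrder-↑ʳ x) (concatOrder-↑ʳ y)

  ¬right-before-left : ∀ y x → ¬ Before (concatOrder f₁ f₂) (m ↑ʳ y) (x ↑ˡ n)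
  ¬right-before-left y x =
    <-asym (subst₂ (λ p q → toℕ p < toℕ q) (sym (concatOrder-↑ˡ x)) (sym (concatOrder-↑ʳ y))
                   (↑ˡ<↑ʳ (f₁ x) (f₂ y)))

module _ (G₁ G₂ : Graph) where
  private
    m n : ℕ
    m = size G₁
    n = size G₂

  noCrossEdge : ∀ y x → ¬ adj (G₁ ⊔ G₂) (m ↑ʳ y) (x ↑ˡ n) ≡ true
  noCrossEdge y x e with () ← trans (sym e) (unionAdj-ʳˡ (adj G₁) (adj G₂) y x)

  ⊔-isModuleSequence : ∀ {f₁ f₂} → IsModuleSequence G₁ f₁ → IsModuleSequence G₂ f₂
                     → IsModuleSequence (G₁ ⊔ G₂) (concatOrder f₁ f₂)
  ⊔-isModuleSequence {f₁} {f₂} S₁ S₂ v a b w na nb pw nw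
    with side m n v | side m n a | side m n b | side m n w
  -- A left vertex: everything before it is left, and G₁'s condition applies.
  ... | left x  | left a' | left b' | left w' =
    embed-moduleCondition G₁ (G₁ ⊔ G₂) {f₁} {concatOrder f₁ f₂} (_↑ˡ n)
                          (unionAdj-ˡˡ (adj G₁) (adj G₂)) (before-↑ˡ f₁ f₂)
                          S₁ x a' b' w' na nb pw nw
  ... | left x  | right a' | _ | _ = ⊥-elim (¬right-before-left f₁ f₂ a' x (proj₁ na))
  ... | left x  | left _ | right b' | _ = ⊥-elim (¬right-before-left f₁ f₂ b' x (proj₁ nb))
  ... | left x  | left _ | left _ | right w' = ⊥-elim (¬right-before-left f₁ f₂ w' x pw)
  -- A right vertex: its neighbours a, b are right, hence both are
  -- non-adjacent to a left w, and G₂'s condition handles a right w.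
  ... | right y | left a' | _ | _ = ⊥-elim (noCrossEdge y a' (proj₂ na))
  ... | right y | right _ | left b' | _ = ⊥-elim (noCrossEdge y b' (proj₂ nb))
  ... | right y | right a' | right b' | left w' =
    trans (unionAdj-ʳˡ (adj G₁) (adj G₂) a' w') (sym (unionAdj-ʳˡ (adj G₁) (adj G₂) b' w'))
  ... | right y | right a' | right b' | right w' =
    embed-moduleCondition G₂ (G₁ ⊔ G₂) {f₂} {concatOrder f₁ f₂} (m ↑ʳ_)
                          (unionAdj-ʳʳ (adj G₁) (adj G₂)) (before-↑ʳ f₁ f₂)
                          S₂ y a' b' w' na nb pw nw

lemma2 : (G₁ G₂ : Graph) → ModuleComposed G₁ → ModuleComposed G₂
       → ModuleComposed (G₁ ⊔ G₂)
lemma2 G₁ G₂ (B₁ , S₁) (B₂ , S₂) = B₁ ++ᵇ B₂ , ⊔-isModuleSequence G₁ G₂ S₁ S₂
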